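{- Let $m\ge 3$ be odd, let $s$ be an even positive integer not divisible by $4$, and let $n=sm$. Define automorphisms of $\Gamma=C_n[mK_1]$ $$\eta_1=(t,t,\dots,t)r,\qquad \eta_2=(\delta_1,\delta_2,\dots,\delta_n)z,$$ where $\delta_{2i+1}=\delta_{2i+2}=tc^{i}$ for $0\le i<n/2$ (so $\eta_2=(t,t,tc,tc,tc^2,tc^2,\dots,tc^{ -1},tc^{ -1})z$), and let $H=\langle\eta_1,\eta_2\rangle$. Then $\eta_1$ has order $n$, $\eta_2$ has order $2m$, $\eta_1\eta_2$ has order $2$, and $|H|=2m^2n$.
   Context: $C_n[mK_1]$ has vertex set $\{1,\dots,n\}\times\{1,\dots,m\}$ with $(i_1,j_1)\sim(i_2,j_2)$ iff $i_1\equiv i_2\pm1\pmod n$ (residues mod $n$ represented by $1,\dots,n$, mod $m$ by $1,\dots,m$). For $\alpha_i\in S_m$ and a permutation $x$ of $\{1,\dots,n\}$, $(\alpha_1,\dots,\alpha_n)x$ is the vertex permutation $(i,j)\mapsto(ix,j\alpha_i)$; permutations act on the right and products are composed left to right. $c=(1\,2\,\cdots\,m)$, $t\in S_m$ fixes $1$ and swaps $j\leftrightarrow m-j+2$ for $2\le j\le m$, $r=(1\,2\,\cdots\,n)$, and $z$ fixes $1$ and swaps $j\leftrightarrow n-j+2$ for $2\le j\le n$. -}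

module Defs where

open import Data.Nat using (ℕ; zero; suc; _+_; _*_; _∸_; _≤_; _<_; _/_)
open import Data.Nat.DivMod using (_mod_)
open import Data.Fin using (Fin; toℕ)
open import Data.Product using (_×_; _,_; Σ)
open import Data.List using (List; length)
open import Data.List.Membership.Propositional using (_∈_)
open import Data.List.Relation.Unary.All using (All)
open import Data.List.Relation.Unary.Any using (Any)
open import Data.List.Relation.Unary.AllPairs using (AllPairs)
open import Relation.Binary.PropositionalEquality using (_≡_)
open import Relation.Nullary using (¬_)

-- Residues are represented 0-based: Fin k element a stands for residue a+1.

sucMod : {k : ℕ} → Fin k → Fin k
sucMod {suc k} a = suc (toℕ a) mod suc k

-- a ↦ - a (mod k)  (0-based; this is j ↦ k - j + 2 fixing 1, 1-based)
negMod : {k : ℕ} → Fin k → Fin k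
negMod {suc k} a = (suc k ∸ toℕ a) mod suc k

_⨾_ : {A : Set} → (A → A) → (A → A) → A → A
(f ⨾ g) x = g (f x)

idf : {A : Set} → A → A
idf x = x

pow : {A : Set} → (A → A) → ℕ → A → A
pow f zero = idf
pow f (suc k) = pow f k ⨾ f

_≈_ : {A : Set} → (A → A) → (A → A) → Set
f ≈ g = ∀ x → f x ≡ g x

-- Vertex set of C_n[mK_1]
V : ℕ → ℕ → Set
V n m = Fin n × Fin m

-- (α_1,…,α_n) x : (i , j) ↦ (i x , j α_i)
wr : {n m : ℕ} → (Fin n → Fin m → Fin m) → (Fin n → Fin n) → V n m → V n m
wr α x (i , j) = (x i , α i j)

c : {m : ℕ} → Fin m → Fin m
c = sucMod
t : {m : ℕ} → Fin m → Fin m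
t = negMod
r : {n : ℕ} → Fin n → Fin n
r = sucMod
z : {n : ℕ} → Fin n → Fin n
z = negMod

η₁ : (n m : ℕ) → V n m → V n m
η₁ n m = wr (λ _ → t) r

-- δ at 0-based position a (1-based a+1 ∈ {2i+1, 2i+2} with i = a / 2) is t c^i
δ : (n m : ℕ) → Fin n → Fin m → Fin m
δ n m a = t ⨾ pow c (toℕ a / 2)

η₂ : (n m : ℕ) → V n m → V n m
η₂ n m = wr (δ n m) z

HasOrder : {A : Set} → (A → A) → ℕ → Set
HasOrder f k = (1 ≤ k) × (pow f k ≈ idf) × (∀ j → 1 ≤ j → j < k → ¬ (pow f j ≈ idf))

-- subgroup generated by a list of permutations (of a set):
-- closed under identity, generators, products, and inverses
-- (h is the inverse of a member g when h ∘ g = id; members are bijections)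
data Gen {A : Set} (gs : List (A → A)) : (A → A) → Set where
  one : Gen gs idf
  gen : ∀ {g} → g ∈ gs → Gen gs g
  mul : ∀ {g h} → Gen gs g → Gen gs h → Gen gs (g ⨾ h)
  inv : ∀ {g h} → Gen gs g → (∀ x → h (g x) ≡ x) → Gen gs h

HasCard : {A : Set} → ((A → A) → Set) → ℕ → Set
HasCard {A} P N = Σ (List (A → A)) λ L →
  (length L ≡ N) × All P L × AllPairs (λ f g → ¬ (f ≈ g)) L
  × (∀ g → P g → Any (λ f → g ≈ f) L)

-- On integer representatives every element of H acts as
--   (i , j) ↦ (±i + k , ±(j + u + v i − b ⌊i/2⌋)),   b = 0 or 1 according to the first sign,
-- with the second sign (−1)^(b+k). Since n = 2wm is even, the parity of k and ⌊i/2⌋ mod m are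
-- well defined, and right multiplication by η₁ or η₂ keeps this shape, so every element of H has
-- such a description. The element is determined by (b, k mod n, u mod m, v mod m), and each of these
-- 2·m·m·n tuples is attained by the word η₂^{2v} (η₁³η₂)^{2u} η₂^b η₁^k, which gives |H|. The orders
-- of η₁, η₂ and η₁η₂ are read off the descriptions of their powers.
module Submission where

open import Defs
open import Data.Nat as ℕ using (ℕ)
open import Relation.Binary.PropositionalEquality using (_≡_)

module Congruence where

  open import Data.Nat as ℕ using (ℕ; zero; suc; _<_; NonZero; _/_; _%_)
  import Data.Nat.Properties as ℕ
  open import Data.Nat.Divisibility as ℕ using (_∣_)
  open import Data.Nat.DivMod using (m≡m%n+[m/n]*n; m%n<n)
  open import Data.Integer as ℤ using (ℤ; +_; -_; _+_; _-_; _*_)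
  import Data.Integer.Properties as ℤ
  open import Data.Integer.Divisibility.Signed as Div using (divides)
    renaming (_∣_ to _∣ᶻ_)
  open import Data.Integer.Tactic.RingSolver using (solve-∀)
  open import Level using (0ℓ)
  open import Relation.Binary.Bundles using (Setoid)
  open import Relation.Binary.PropositionalEquality
  open import Relation.Nullary using (contradiction)
  open import Function using (_∘_)

  infix 4 _≡_[mod_]
  record _≡_[mod_] (x y : ℤ) (k : ℕ) : Set where
    constructor ≡mod
    field ∣-difference : + k ∣ᶻ x - y

  module _ {k : ℕ} where

    mod-reflexive : ∀ {x y} → x ≡ y → x ≡ y [mod k ]
    mod-reflexive {x} refl = ≡mod (divides (+ 0) (trans (ℤ.+-inverseʳ x) (sym (ℤ.*-zeroˡ (+ k)))))

    mod-refl : ∀ {x} → x ≡ x [mod k ]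
    mod-refl = mod-reflexive refl

    mod-sym : ∀ {x y} → x ≡ y [mod k ] → y ≡ x [mod k ]
    mod-sym {x} {y} (≡mod p) = ≡mod (subst (+ k ∣ᶻ_) (lemma x y) (Div.∣m⇒∣-m p))
      where
      lemma : ∀ x y → - (x - y) ≡ y - x
      lemma = solve-∀

    mod-trans : ∀ {x y z} → x ≡ y [mod k ] → y ≡ z [mod k ] → x ≡ z [mod k ]
    mod-trans {x} {y} {z} (≡mod p) (≡mod q) =
      ≡mod (subst (+ k ∣ᶻ_) (lemma x y z) (Div.∣m∣n⇒∣m+n p q))
      where
      lemma : ∀ x y z → (x - y) + (y - z) ≡ x - z
      lemma = solve-∀

    mod-+ : ∀ {x x′ y y′} → x ≡ x′ [mod k ] → y ≡ y′ [mod k ] → x + y ≡ x′ + y′ [mod k ]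
    mod-+ {x} {x′} {y} {y′} (≡mod p) (≡mod q) =
      ≡mod (subst (+ k ∣ᶻ_) (lemma x x′ y y′) (Div.∣m∣n⇒∣m+n p q))
      where
      lemma : ∀ x x′ y y′ → (x - x′) + (y - y′) ≡ (x + y) - (x′ + y′)
      lemma = solve-∀

    mod-+ˡ : ∀ a {x x′} → x ≡ x′ [mod k ] → a + x ≡ a + x′ [mod k ]
    mod-+ˡ a = mod-+ (mod-refl {x = a})

    mod-+ʳ : ∀ a {x x′} → x ≡ x′ [mod k ] → x + a ≡ x′ + a [mod k ]
    mod-+ʳ a p = mod-+ p (mod-refl {x = a})

    mod-neg : ∀ {x x′} → x ≡ x′ [mod k ] → - x ≡ - x′ [mod k ]
    mod-neg {x} {x′} (≡mod p) = ≡mod (subst (+ k ∣ᶻ_) (lemma x x′) (Div.∣m⇒∣-m p))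
      where
      lemma : ∀ x x′ → - (x - x′) ≡ - x - - x′
      lemma = solve-∀

    mod-*ˡ : ∀ a {x x′} → x ≡ x′ [mod k ] → a * x ≡ a * x′ [mod k ]
    mod-*ˡ a {x} {x′} (≡mod p) = ≡mod (subst (+ k ∣ᶻ_) (lemma a x x′) (Div.∣n⇒∣m*n a p))
      where
      lemma : ∀ a x x′ → a * (x - x′) ≡ a * x - a * x′
      lemma = solve-∀

    mod-*ʳ : ∀ a {x x′} → x ≡ x′ [mod k ] → x * a ≡ x′ * a [mod k ]
    mod-*ʳ a {x} {x′} p = subst₂ _≡_[mod k ] (ℤ.*-comm a x) (ℤ.*-comm a x′) (mod-*ˡ a p)

    mod-multiple : ∀ x q → x + q * + k ≡ x [mod k ]
    mod-multiple x q = ≡mod (divides q (lemma x q (+ k)))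
      where
      lemma : ∀ x q k → (x + q * k) - x ≡ q * k
      lemma = solve-∀

    mod-+-modulus : ∀ x → x + + k ≡ x [mod k ]
    mod-+-modulus x = subst (λ y → x + y ≡ x [mod k ]) (ℤ.*-identityˡ (+ k)) (mod-multiple x (+ 1))

  mod-setoid : ℕ → Setoid 0ℓ 0ℓ
  mod-setoid k = record
    { Carrier = ℤ
    ; _≈_ = _≡_[mod k ]
    ; isEquivalence = record { refl = mod-refl ; sym = mod-sym ; trans = mod-trans }
    }

  mod-weaken : ∀ {d k x y} → d ∣ k → x ≡ y [mod k ] → x ≡ y [mod d ]
  mod-weaken d∣k (≡mod p) = ≡mod (Div.∣-trans (Div.∣ᵤ⇒∣ d∣k) p)

  mod-*-cancelˡ : ∀ d {k x y} .{{_ : NonZero d}} → + d * x ≡ + d * y [mod d ℕ.* k ] → x ≡ y [mod k ]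
  mod-*-cancelˡ d {k} {x} {y} (≡mod p) = ≡mod (Div.*-cancelˡ-∣ (+ d)
    (subst₂ _∣ᶻ_ (ℤ.pos-* d k) (lemma (+ d) x y) p))
    where
    lemma : ∀ d x y → d * x - d * y ≡ d * (x - y)
    lemma = solve-∀

  mod-division : ∀ {x k} r q → x ≡ + r + q * + k → + r ≡ x [mod k ]
  mod-division {x} {k} r q refl = mod-sym (mod-multiple (+ r) q)

  mod-%-self : ∀ x k .{{_ : NonZero k}} → + (x % k) ≡ + x [mod k ]
  mod-%-self x k = mod-division (x % k) (+ (x / k))
    (trans (cong +_ (m≡m%n+[m/n]*n x k))
      (trans (ℤ.pos-+ (x % k) (x / k ℕ.* k)) (cong (_+_ (+ (x % k))) (ℤ.pos-* (x / k) k))))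

  <-mod-injective : ∀ {a b k} → a < k → b < k → + a ≡ + b [mod k ] → a ≡ b
  <-mod-injective {a} {b} {k} a<k b<k p =
    ℤ.+-injective (ℤ.i-j≡0⇒i≡j (+ a) (+ b) (ℤ.∣i∣≡0⇒i≡0 distance≡0))
    where
    distance<k : ℤ.∣ + a - + b ∣ < k
    distance<k = subst (_< k) (cong ℤ.∣_∣ (sym (ℤ.m-n≡m⊖n a b)))
      (ℕ.≤-<-trans (ℤ.∣m⊝n∣≤m⊔n a b) (ℕ.⊔-pres-<m a<k b<k))
    divides-distance : k ℕ.∣ ℤ.∣ + a - + b ∣
    divides-distance = Div.∣⇒∣ᵤ (_≡_[mod_].∣-difference p)
    distance≡0 : ℤ.∣ + a - + b ∣ ≡ 0
    distance≡0 with ℤ.∣ + a - + b ∣ | distance<k | divides-distance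
    ... | zero  | _ | _ = refl
    ... | suc d | d<k | k∣d = contradiction k∣d (ℕ.>⇒∤ d<k)

  parity-mod : ∀ {x n a e} → 2 ∣ n → + x ≡ + 2 * a + + e [mod n ] → e < 2 → x % 2 ≡ e
  parity-mod {x} {n} {a} {e} 2∣n p e<2 = <-mod-injective (m%n<n x 2) e<2 (begin
      + (x % 2)        ≈⟨ mod-%-self x 2 ⟩
      + x              ≈⟨ mod-weaken 2∣n p ⟩
      + 2 * a + + e    ≡⟨ ℤ.+-comm (+ 2 * a) (+ e) ⟩
      + e + + 2 * a    ≡⟨ cong (_+_ (+ e)) (ℤ.*-comm (+ 2) a) ⟩
      + e + a * + 2    ≈⟨ mod-multiple (+ e) a ⟩
      + e              ∎)
    where open import Relation.Binary.Reasoning.Setoid (mod-setoid 2)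

  mod-+-cancelʳ : ∀ {k x y} c → x + c ≡ y + c [mod k ] → x ≡ y [mod k ]
  mod-+-cancelʳ {k} {x} {y} c p = begin
      x              ≡⟨ lemma x c ⟨
      (x + c) + - c  ≈⟨ mod-+ʳ (- c) p ⟩
      (y + c) + - c  ≡⟨ lemma y c ⟩
      y              ∎
    where
    open import Relation.Binary.Reasoning.Setoid (mod-setoid k)
    lemma : ∀ x c → (x + c) + - c ≡ x
    lemma = solve-∀

  +-half-parity : ∀ x → + x ≡ + 2 * + (x / 2) + + (x % 2)
  +-half-parity x = trans (cong +_ (trans (m≡m%n+[m/n]*n x 2) (ℕ.+-comm (x % 2) (x / 2 ℕ.* 2))))
    (trans (ℤ.pos-+ (x / 2 ℕ.* 2) (x % 2))
      (cong (_+ + (x % 2)) (trans (ℤ.pos-* (x / 2) 2) (ℤ.*-comm (+ (x / 2)) (+ 2)))))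

  mod-half : ∀ {n m w X K e} → n ≡ 2 ℕ.* (w ℕ.* m) →
             + X ≡ + 2 * K + + e [mod n ] → e < 2 → + (X / 2) ≡ K [mod m ]
  mod-half {n} {m} {w} {X} {K} {e} refl p e<2 =
    mod-weaken (ℕ.n∣m*n w) (mod-*-cancelˡ 2 (mod-+-cancelʳ (+ e) (begin
      + 2 * + (X / 2) + + e        ≡⟨ cong (_+_ (+ 2 * + (X / 2)) ∘ +_) X%2≡e ⟨
      + 2 * + (X / 2) + + (X % 2)  ≡⟨ +-half-parity X ⟨
      + X                          ≈⟨ p ⟩
      + 2 * K + + e                ∎)))
    where
    open import Relation.Binary.Reasoning.Setoid (mod-setoid n)
    X%2≡e : X % 2 ≡ e
    X%2≡e = parity-mod {a = K} (ℕ.m∣m*n (w ℕ.* m)) p e<2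

module Iteration {A : Set} where

  open import Data.Nat as ℕ using (ℕ; zero; suc; _%_)
  import Data.Nat.Properties as ℕ
  open import Data.Nat.DivMod using ([m+n]%n≡m%n)
  open import Relation.Binary.PropositionalEquality

  pow-double : ∀ (f : A → A) q x → pow f (q ℕ.* 2) x ≡ pow (f ⨾ f) q x
  pow-double f zero    x = refl
  pow-double f (suc q) x = cong (f ⨾ f) (pow-double f q x)

  pow-involution : ∀ {f : A → A} → (∀ x → f (f x) ≡ x) → ∀ k x → pow f k x ≡ pow f (k % 2) x
  pow-involution f² zero          x = refl
  pow-involution f² (suc zero)    x = refl
  pow-involution {f} f² (suc (suc k)) x = begin
    f (f (pow f k x))          ≡⟨ f² (pow f k x) ⟩
    pow f k x                  ≡⟨ pow-involution f² k x ⟩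
    pow f (k % 2) x            ≡⟨ cong (λ r → pow f r x) ([m+n]%n≡m%n k 2) ⟨
    pow f ((k ℕ.+ 2) % 2) x    ≡⟨ cong (λ r → pow f (r % 2) x) (ℕ.+-comm k 2) ⟩
    pow f (suc (suc k) % 2) x  ∎
    where open ≡-Reasoning

module Enumeration {A : Set} where

  open import Data.Fin using (Fin)
  open import Data.List using (map; allFin)
  import Data.List.Properties as List
  import Data.List.Relation.Unary.All.Properties as All
  import Data.List.Relation.Unary.Any.Properties as Any
  import Data.List.Relation.Unary.AllPairs as AllPairs
  import Data.List.Relation.Unary.AllPairs.Properties as AllPairs
  import Data.List.Relation.Unary.Unique.Propositional.Properties as Unique
  open import Data.Product using (Σ; _,_)
  open import Relation.Binary.PropositionalEquality

  hasCard-enumeration : ∀ {P : (A → A) → Set} {N} (f : Fin N → A → A) →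
    (∀ x → P (f x)) → (∀ x y → f x ≈ f y → x ≡ y) → (∀ g → P g → Σ (Fin N) λ x → g ≈ f x) →
    HasCard P N
  hasCard-enumeration {N = N} f P-f f-injective complete =
      map f (allFin N)
    , trans (List.length-map f (allFin N)) (List.length-tabulate (λ x → x))
    , All.map⁺ (All.tabulate⁺ P-f)
    , AllPairs.map⁺ (AllPairs.map (λ {x} {y} x≢y fx≈fy → x≢y (f-injective x y fx≈fy)) (Unique.allFin⁺ N))
    , λ g Pg → let x , g≈fx = complete g Pg in Any.map⁺ (Any.tabulate⁺ x g≈fx)

module Representatives where

  open Congruence
  open import Data.Nat as ℕ using (ℕ; zero; suc; _<_; NonZero; _%_; _∸_)
  import Data.Nat.Properties as ℕ
  open import Data.Nat.DivMod using (m%n<n)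
  open import Data.Fin using (Fin; toℕ; fromℕ<)
  import Data.Fin.Properties as Fin
  open import Data.Integer as ℤ using (ℤ; +_; -_; _+_; _-_; _*_)
  import Data.Integer.Properties as ℤ
  open import Data.Integer.DivMod using (_%ℕ_; _/ℕ_; n%ℕd<d; a≡a%ℕn+[a/ℕn]*n)
  open import Data.Integer.Tactic.RingSolver using (solve-∀)
  open import Relation.Binary.PropositionalEquality
  open import Function using (_∘_)

  rep : ∀ {k} → Fin k → ℤ
  rep a = + toℕ a

  rep-fromℕ< : ∀ {a k} (a<k : a < k) → rep (fromℕ< a<k) ≡ + a
  rep-fromℕ< a<k = cong +_ (Fin.toℕ-fromℕ< a<k)

  rep-injective : ∀ {k} {a b : Fin k} → rep a ≡ rep b [mod k ] → a ≡ b
  rep-injective = Fin.toℕ-injective ∘ <-mod-injective (Fin.toℕ<n _) (Fin.toℕ<n _)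

  residue : ∀ k .{{_ : NonZero k}} → ℤ → Fin k
  residue k z = fromℕ< (n%ℕd<d z k)

  rep-residue : ∀ k .{{_ : NonZero k}} z → rep (residue k z) ≡ z [mod k ]
  rep-residue k z = subst (_≡ z [mod k ]) (sym (rep-fromℕ< (n%ℕd<d z k)))
    (mod-division (z %ℕ k) (z /ℕ k) (a≡a%ℕn+[a/ℕn]*n z k))

  rep-sucMod : ∀ {k} (a : Fin k) → rep (sucMod a) ≡ rep a + + 1 [mod k ]
  rep-sucMod {suc k} a = subst₂ _≡_[mod suc k ] (sym (rep-fromℕ< (m%n<n (suc (toℕ a)) (suc k))))
    (trans (cong +_ (ℕ.+-comm 1 (toℕ a))) (ℤ.pos-+ (toℕ a) 1)) (mod-%-self (suc (toℕ a)) (suc k))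

  rep-negMod : ∀ {k} (a : Fin k) → rep (negMod a) ≡ - rep a [mod k ]
  rep-negMod {suc k} a = begin
      rep (negMod a)          ≡⟨ rep-fromℕ< (m%n<n (suc k ∸ toℕ a) (suc k)) ⟩
      + ((suc k ∸ toℕ a) % suc k) ≈⟨ mod-%-self (suc k ∸ toℕ a) (suc k) ⟩
      + (suc k ∸ toℕ a)       ≡⟨ ℤ.⊖-≥ (ℕ.<⇒≤ (Fin.toℕ<n a)) ⟨
      suc k ℤ.⊖ toℕ a         ≡⟨ ℤ.m-n≡m⊖n (suc k) (toℕ a) ⟨
      + suc k - rep a         ≡⟨ lemma (+ suc k) (rep a) ⟩
      - rep a + + 1 * + suc k ≈⟨ mod-multiple (- rep a) (+ 1) ⟩
      - rep a                 ∎
    where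
    open import Relation.Binary.Reasoning.Setoid (mod-setoid (suc k))
    lemma : ∀ k a → k - a ≡ - a + + 1 * k
    lemma = solve-∀

  rep-pow-sucMod : ∀ {k} h (a : Fin k) → rep (pow sucMod h a) ≡ rep a + + h [mod k ]
  rep-pow-sucMod         zero    a = mod-reflexive (sym (ℤ.+-identityʳ (rep a)))
  rep-pow-sucMod {k} (suc h) a = begin
      rep (sucMod (pow sucMod h a)) ≈⟨ rep-sucMod (pow sucMod h a) ⟩
      rep (pow sucMod h a) + + 1    ≈⟨ mod-+ (rep-pow-sucMod h a) (mod-refl {x = + 1}) ⟩
      rep a + + h + + 1             ≡⟨ ℤ.+-assoc (rep a) (+ h) (+ 1) ⟩
      rep a + + (h ℕ.+ 1)           ≡⟨ cong (_+_ (rep a) ∘ +_) (ℕ.+-comm h 1) ⟩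
      rep a + + suc h               ∎
    where open import Relation.Binary.Reasoning.Setoid (mod-setoid k)

module Realisation (n m w : ℕ) (n≡2wm : n ≡ 2 ℕ.* (w ℕ.* m)) where

  open Congruence
  open Representatives
  open Iteration
  open import Data.Nat as ℕ using (ℕ; zero; suc; _<_; s≤s; z≤n; _/_; _%_; NonZero)
  import Data.Nat.Divisibility as ℕ
  import Data.Nat.Properties as ℕ
  open import Data.Nat.DivMod using (m%n<n)
  open import Data.Bool using (Bool; true; false; _xor_)
  open import Data.Fin using (Fin; toℕ)
  open import Data.Integer as ℤ using (ℤ; +_; -_; _+_; _-_; _*_)
  import Data.Integer.Properties as ℤ
  open import Data.Integer.Tactic.RingSolver using (solve-∀)
  open import Data.Product using (Σ; _×_; _,_; proj₁; proj₂)
  open import Data.List using (List; _∷_; [])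
  open import Data.List.Relation.Unary.Any using (here; there)
  open import Relation.Binary.PropositionalEquality
  open import Function using (_∘_; id)

  -- ⟨ b , f , a , u , v ⟩ stands for the map (i , j) ↦ (±i + 2a + f , ±(j + u + v i − b ⌊i/2⌋))
  -- on representatives, where the first sign is that of b and the second that of b xor f.
  record Params : Set where
    constructor ⟨_,_,_,_,_⟩
    field
      reflecting : Bool
      odd        : Bool
      halfShift  : ℤ
      offset     : ℤ
      slope      : ℤ

  signed : Bool → ℤ → ℤ
  signed false x = x
  signed true  x = - x

  bit : Bool → ℕ
  bit false = 0
  bit true  = 1

  first : Params → ℤ → ℤ
  first ⟨ b , f , a , _ , _ ⟩ i = signed b i + (+ 2 * a + + bit f)

  second : Params → (i j h : ℤ) → ℤ
  second ⟨ b , f , _ , u , v ⟩ i j h = signed (b xor f) (j + u + v * i - + bit b * h)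

  half : Fin n → ℤ
  half i = + (toℕ i / 2)

  signed-involutive : ∀ b x → signed b (signed b x) ≡ x
  signed-involutive false x = refl
  signed-involutive true  x = ℤ.neg-involutive x

  signed-xor : ∀ b f x → signed (b xor f) x ≡ signed f (signed b x)
  signed-xor false f     x = refl
  signed-xor true  false x = refl
  signed-xor true  true  x = sym (ℤ.neg-involutive x)

  signed-cong : ∀ {k} b {x y} → x ≡ y [mod k ] → signed b x ≡ signed b y [mod k ]
  signed-cong false = id
  signed-cong true  = mod-neg

  signed-cancel : ∀ {k} b {x y} → signed b x ≡ signed b y [mod k ] → x ≡ y [mod k ]
  signed-cancel b {x} {y} = subst₂ _≡_[mod _ ] (signed-involutive b x) (signed-involutive b y) ∘ signed-cong b

  signed≡pow-neg : ∀ f x → signed f x ≡ pow -_ (bit f) x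
  signed≡pow-neg false x = refl
  signed≡pow-neg true  x = refl

  pow-neg-cancel : ∀ {k} r {x y} → pow -_ r x ≡ pow -_ r y [mod k ] → x ≡ y [mod k ]
  pow-neg-cancel zero    = id
  pow-neg-cancel (suc r) = pow-neg-cancel r ∘ signed-cancel true

  bit<2 : ∀ f → bit f < 2
  bit<2 false = s≤s z≤n
  bit<2 true  = s≤s (s≤s z≤n)

  infix 4 _⟨_⟩↦_
  record _⟨_⟩↦_ (x : V n m) (p : Params) (y : V n m) : Set where
    constructor maps
    field
      first-≡  : rep (proj₁ y) ≡ first p (rep (proj₁ x)) [mod n ]
      second-≡ : rep (proj₂ y) ≡ second p (rep (proj₁ x)) (rep (proj₂ x)) (half (proj₁ x)) [mod m ]

  record Realises (g : V n m → V n m) (p : Params) : Set where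
    constructor realises
    field at : ∀ x → x ⟨ p ⟩↦ g x
  open Realises public

  infix 4 _≅_
  _≅_ : Params → Params → Set
  p ≅ q = (∀ i → first p i ≡ first q i [mod n ])
        × (∀ i j h → second p i j h ≡ second q i j h [mod m ])

  ↦-unique : ∀ {x p y y′} → x ⟨ p ⟩↦ y → x ⟨ p ⟩↦ y′ → y ≡ y′
  ↦-unique (maps ρ₁ ρ₂) (maps σ₁ σ₂) = cong₂ _,_ (rep-injective (mod-trans ρ₁ (mod-sym σ₁)))
                                           (rep-injective (mod-trans ρ₂ (mod-sym σ₂)))

  realises-≅ : ∀ {g p q} → Realises g p → p ≅ q → Realises g q
  realises-≅ (realises ρ) (≅₁ , ≅₂) = realises λ (i , j) → let maps ρ₁ ρ₂ = ρ (i , j) in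
    maps (mod-trans ρ₁ (≅₁ (rep i))) (mod-trans ρ₂ (≅₂ (rep i) (rep j) (half i)))

  realises-resp-≈ : ∀ {g h p} → g ≈ h → Realises g p → Realises h p
  realises-resp-≈ {p = p} g≈h (realises ρ) = realises λ x → subst (x ⟨ p ⟩↦_) (g≈h x) (ρ x)

  realisations-agree : ∀ {g p q} → Realises g p → Realises g q → ∀ i j →
      first p (rep i) ≡ first q (rep i) [mod n ]
    × second p (rep i) (rep j) (half i) ≡ second q (rep i) (rep j) (half i) [mod m ]
  realisations-agree (realises ρ) (realises σ) i j with ρ (i , j) | σ (i , j)
  ... | maps ρ₁ ρ₂ | maps σ₁ σ₂ = mod-trans (mod-sym ρ₁) σ₁ , mod-trans (mod-sym ρ₂) σ₂

  ≈-from-realisations : ∀ {g h p} → Realises g p → Realises h p → g ≈ h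
  ≈-from-realisations (realises ρ) (realises σ) x = ↦-unique (ρ x) (σ x)

  origin : Params
  origin = ⟨ false , false , + 0 , + 0 , + 0 ⟩

  realises-idf : Realises idf origin
  realises-idf = realises λ (i , j) →
    maps (mod-reflexive (lemma₁ (rep i))) (mod-reflexive (lemma₂ (rep i) (rep j) (half i)))
    where
    lemma₁ : ∀ i → i ≡ i + (+ 2 * + 0 + + 0)
    lemma₁ = solve-∀
    lemma₂ : ∀ i j h → j ≡ j + + 0 + + 0 * i - + 0 * h
    lemma₂ = solve-∀

  _·η₁ : Params → Params
  ⟨ b , false , a , u , v ⟩ ·η₁ = ⟨ b , true  , a       , u , v ⟩
  ⟨ b , true  , a , u , v ⟩ ·η₁ = ⟨ b , false , a + + 1 , u , v ⟩

  first-·η₁ : ∀ p i → first (p ·η₁) i ≡ first p i + + 1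
  first-·η₁ ⟨ b , false , a , _ , _ ⟩ i = lemma (signed b i) a
    where
    lemma : ∀ x a → x + (+ 2 * a + + 1) ≡ x + (+ 2 * a + + 0) + + 1
    lemma = solve-∀
  first-·η₁ ⟨ b , true  , a , _ , _ ⟩ i = lemma (signed b i) a
    where
    lemma : ∀ x a → x + (+ 2 * (a + + 1) + + 0) ≡ x + (+ 2 * a + + 1) + + 1
    lemma = solve-∀

  second-·η₁ : ∀ p i j h → second (p ·η₁) i j h ≡ - second p i j h
  second-·η₁ ⟨ false , false , _ , _ , _ ⟩ i j h = refl
  second-·η₁ ⟨ false , true  , _ , _ , _ ⟩ i j h = sym (ℤ.neg-involutive _)
  second-·η₁ ⟨ true  , false , _ , _ , _ ⟩ i j h = sym (ℤ.neg-involutive _)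
  second-·η₁ ⟨ true  , true  , _ , _ , _ ⟩ i j h = refl

  ↦-·η₁ : ∀ {x p y} → x ⟨ p ⟩↦ y → x ⟨ p ·η₁ ⟩↦ η₁ n m y
  ↦-·η₁ {i , j} {p} {a , b} (maps ρ₁ ρ₂) = maps
      (mod-trans (rep-sucMod a) (mod-trans (mod-+ʳ (+ 1) ρ₁) (mod-reflexive (sym (first-·η₁ p (rep i))))))
      (mod-trans (rep-negMod b) (mod-trans (mod-neg ρ₂) (mod-reflexive (sym (second-·η₁ p (rep i) (rep j) (half i))))))

  _·η₂ : Params → Params
  ⟨ false , false , a , u , v ⟩ ·η₂ = ⟨ true  , false , - a       , u - a , v       ⟩
  ⟨ false , true  , a , u , v ⟩ ·η₂ = ⟨ true  , true  , - a - + 1 , u + a , v + + 1 ⟩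
  ⟨ true  , false , a , u , v ⟩ ·η₂ = ⟨ false , false , - a       , u + a , v - + 1 ⟩
  ⟨ true  , true  , a , u , v ⟩ ·η₂ = ⟨ false , true  , - a - + 1 , u - a , v       ⟩

  first-·η₂ : ∀ p i → first (p ·η₂) i ≡ - first p i
  first-·η₂ ⟨ false , false , a , _ , _ ⟩ i = lemma i a
    where
    lemma : ∀ i a → - i + (+ 2 * - a + + 0) ≡ - (i + (+ 2 * a + + 0))
    lemma = solve-∀
  first-·η₂ ⟨ false , true  , a , _ , _ ⟩ i = lemma i a
    where
    lemma : ∀ i a → - i + (+ 2 * (- a - + 1) + + 1) ≡ - (i + (+ 2 * a + + 1))
    lemma = solve-∀
  first-·η₂ ⟨ true  , false , a , _ , _ ⟩ i = lemma i a
    where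
    lemma : ∀ i a → i + (+ 2 * - a + + 0) ≡ - (- i + (+ 2 * a + + 0))
    lemma = solve-∀
  first-·η₂ ⟨ true  , true  , a , _ , _ ⟩ i = lemma i a
    where
    lemma : ∀ i a → i + (+ 2 * (- a - + 1) + + 1) ≡ - (- i + (+ 2 * a + + 1))
    lemma = solve-∀

  +[1∸r]≡1-r : ∀ {r} → r < 2 → + (1 ℕ.∸ r) ≡ + 1 - + r
  +[1∸r]≡1-r {zero}  _ = refl
  +[1∸r]≡1-r {suc zero} _ = refl
  +[1∸r]≡1-r {suc (suc _)} (s≤s (s≤s ()))

  -- η₂ adds ⌊i′/2⌋ to the second coordinate, where i′ = first p i. For i = 2h + r this records
  -- i′ = 2q + r′ with q polynomial in h and r, which keeps the image of the described shape.
  record Halving (p : Params) (i h : ℤ) : Set where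
    field
      quotient    : ℤ
      remainder   : ℕ
      remainder<2 : remainder < 2
      first-split : first p i ≡ + 2 * quotient + + remainder
      second-·η₂  : ∀ j → - second p i j h + quotient ≡ second (p ·η₂) i j h

  halving : ∀ p h r → r < 2 → Halving p (+ 2 * h + + r) h
  halving ⟨ false , false , a , u , v ⟩ h r r<2 = record
    { quotient = h + a ; remainder = r ; remainder<2 = r<2
    ; first-split = lemma₁ h (+ r) a
    ; second-·η₂ = λ j → lemma₂ h (+ r) a u v j }
    where
    lemma₁ : ∀ h r a → (+ 2 * h + r) + (+ 2 * a + + 0) ≡ + 2 * (h + a) + r
    lemma₁ = solve-∀
    lemma₂ : ∀ h r a u v j → - (j + u + v * (+ 2 * h + r) - + 0 * h) + (h + a)
                          ≡ - (j + (u - a) + v * (+ 2 * h + r) - + 1 * h)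
    lemma₂ = solve-∀
  halving ⟨ false , true , a , u , v ⟩ h r r<2 = record
    { quotient = h + a + + r ; remainder = 1 ℕ.∸ r ; remainder<2 = s≤s (ℕ.m∸n≤m 1 r)
    ; first-split = trans (lemma₁ h (+ r) a) (cong (_+_ (+ 2 * (h + a + + r))) (sym (+[1∸r]≡1-r r<2)))
    ; second-·η₂ = λ j → lemma₂ h (+ r) a u v j }
    where
    lemma₁ : ∀ h r a → (+ 2 * h + r) + (+ 2 * a + + 1) ≡ + 2 * (h + a + r) + (+ 1 - r)
    lemma₁ = solve-∀
    lemma₂ : ∀ h r a u v j → - - (j + u + v * (+ 2 * h + r) - + 0 * h) + (h + a + r)
                          ≡ j + (u + a) + (v + + 1) * (+ 2 * h + r) - + 1 * h
    lemma₂ = solve-∀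
  halving ⟨ true , false , a , u , v ⟩ h r r<2 = record
    { quotient = a - h - + r ; remainder = r ; remainder<2 = r<2
    ; first-split = lemma₁ h (+ r) a
    ; second-·η₂ = λ j → lemma₂ h (+ r) a u v j }
    where
    lemma₁ : ∀ h r a → - (+ 2 * h + r) + (+ 2 * a + + 0) ≡ + 2 * (a - h - r) + r
    lemma₁ = solve-∀
    lemma₂ : ∀ h r a u v j → - - (j + u + v * (+ 2 * h + r) - + 1 * h) + (a - h - r)
                          ≡ j + (u + a) + (v - + 1) * (+ 2 * h + r) - + 0 * h
    lemma₂ = solve-∀
  halving ⟨ true , true , a , u , v ⟩ h r r<2 = record
    { quotient = a - h ; remainder = 1 ℕ.∸ r ; remainder<2 = s≤s (ℕ.m∸n≤m 1 r)
    ; first-split = trans (lemma₁ h (+ r) a) (cong (_+_ (+ 2 * (a - h))) (sym (+[1∸r]≡1-r r<2)))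
    ; second-·η₂ = λ j → lemma₂ h (+ r) a u v j }
    where
    lemma₁ : ∀ h r a → - (+ 2 * h + r) + (+ 2 * a + + 1) ≡ + 2 * (a - h) + (+ 1 - r)
    lemma₁ = solve-∀
    lemma₂ : ∀ h r a u v j → - (j + u + v * (+ 2 * h + r) - + 1 * h) + (a - h)
                          ≡ - (j + (u - a) + v * (+ 2 * h + r) - + 0 * h)
    lemma₂ = solve-∀

  ↦-·η₂ : ∀ {x p y} → x ⟨ p ⟩↦ y → x ⟨ p ·η₂ ⟩↦ η₂ n m y
  ↦-·η₂ {i , j} {p} {a , b} (maps ρ₁ ρ₂) = maps
      (mod-trans (rep-negMod a) (mod-trans (mod-neg ρ₁) (mod-reflexive (sym (first-·η₂ p (rep i))))))
      (mod-trans (rep-pow-sucMod (toℕ a / 2) (negMod b))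
        (mod-trans (mod-+ (mod-trans (rep-negMod b) (mod-neg ρ₂)) half-a)
          (mod-reflexive (second-·η₂ (rep j)))))
    where
    halving-i : Halving p (rep i) (half i)
    halving-i = subst (λ x → Halving p x (half i)) (sym (+-half-parity (toℕ i)))
      (halving p (half i) (toℕ i % 2) (m%n<n (toℕ i) 2))
    open Halving halving-i
    half-a : + (toℕ a / 2) ≡ quotient [mod m ]
    half-a = mod-half {w = w} n≡2wm (mod-trans ρ₁ (mod-reflexive first-split)) remainder<2

  generators : List (V n m → V n m)
  generators = η₁ n m ∷ η₂ n m ∷ []

  infixl 5 _∷η₁ _∷η₂
  data Word : (V n m → V n m) → (Params → Params) → Set where
    []   : Word idf idf
    _∷η₁ : ∀ {w φ} → Word w φ → Word (w ⨾ η₁ n m) (φ ⨾ _·η₁)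
    _∷η₂ : ∀ {w φ} → Word w φ → Word (w ⨾ η₂ n m) (φ ⨾ _·η₂)

  realises-word : ∀ {w φ g p} → Word w φ → Realises g p → Realises (g ⨾ w) (φ p)
  realises-word []       ρ = ρ
  realises-word (W ∷η₁) ρ = realises (↦-·η₁ ∘ at (realises-word W ρ))
  realises-word (W ∷η₂) ρ = realises (↦-·η₂ ∘ at (realises-word W ρ))

  word-∈ : ∀ {w φ} → Word w φ → Gen generators w
  word-∈ []       = one
  word-∈ (W ∷η₁) = mul (word-∈ W) (gen (here refl))
  word-∈ (W ∷η₂) = mul (word-∈ W) (gen (there (here refl)))

  word-++ : ∀ {u v φ ψ} → Word u φ → Word v ψ → Word (u ⨾ v) (φ ⨾ ψ)
  word-++ U []       = U
  word-++ U (V ∷η₁) = word-++ U V ∷η₁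
  word-++ U (V ∷η₂) = word-++ U V ∷η₂

  word-pow : ∀ {w φ} → Word w φ → ∀ k → Word (pow w k) (pow φ k)
  word-pow W zero    = []
  word-pow W (suc k) = word-++ (word-pow W k) W

  record PositiveWord : Set where
    constructor ⟪_⟫
    field
      {perm}   : V n m → V n m
      {action} : Params → Params
      word     : Word perm action
  open PositiveWord public

  infixl 6 _·ʷ_
  infixl 7 _^ʷ_
  _·ʷ_ : PositiveWord → PositiveWord → PositiveWord
  ⟪ U ⟫ ·ʷ ⟪ V ⟫ = ⟪ word-++ U V ⟫

  _^ʷ_ : PositiveWord → ℕ → PositiveWord
  ⟪ W ⟫ ^ʷ k = ⟪ word-pow W k ⟫

  η₁ʷ η₂ʷ : PositiveWord
  η₁ʷ = ⟪ [] ∷η₁ ⟫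
  η₂ʷ = ⟪ [] ∷η₂ ⟫

  -- The inverse of a generator is a positive power of it, so every word has a right inverse word.
  rightInverse : ∀ N₁ N₂ → pow (η₁ n m) (suc N₁) ≈ idf → pow (η₂ n m) (suc N₂) ≈ idf →
                 ∀ {w φ} → Word w φ → Σ PositiveWord λ W′ → ∀ x → w (perm W′ x) ≡ x
  rightInverse N₁ N₂ η₁-order η₂-order []       = ⟪ [] ⟫ , λ _ → refl
  rightInverse N₁ N₂ η₁-order η₂-order (W ∷η₁) with rightInverse N₁ N₂ η₁-order η₂-order W
  ... | W′ , cancels = η₁ʷ ^ʷ N₁ ·ʷ W′ , λ x → trans (cong (η₁ n m) (cancels _)) (η₁-order x)
  rightInverse N₁ N₂ η₁-order η₂-order (W ∷η₂) with rightInverse N₁ N₂ η₁-order η₂-order W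
  ... | W′ , cancels = η₂ʷ ^ʷ N₂ ·ʷ W′ , λ x → trans (cong (η₂ n m) (cancels _)) (η₂-order x)

  Index : Set
  Index = ((Bool × Fin m) × Fin m) × Fin n

  pattern index b u v k = ((b , u) , v) , k

  bumpʷ : PositiveWord
  bumpʷ = (η₁ʷ ^ʷ 3 ·ʷ η₂ʷ) ^ʷ 2

  reflectʷ : Bool → PositiveWord
  reflectʷ false = ⟪ [] ⟫
  reflectʷ true  = η₂ʷ

  canonicalʷ : Index → PositiveWord
  canonicalʷ (index b u v k) = (η₂ʷ ·ʷ η₂ʷ) ^ʷ toℕ v ·ʷ bumpʷ ^ʷ toℕ u ·ʷ reflectʷ b ·ʷ η₁ʷ ^ʷ toℕ k

  canonical : Index → Params
  canonical (index b u v k) = pow _·η₁ (toℕ k) ⟨ b , false , + 0 , rep u , - rep v ⟩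

  action-η₂η₂ : ∀ v → pow (_·η₂ ⨾ _·η₂) v origin ≡ ⟨ false , false , + 0 , + 0 , - + v ⟩
  action-η₂η₂ zero    = refl
  action-η₂η₂ (suc v) =
    trans (cong (_·η₂ ⨾ _·η₂) (action-η₂η₂ v)) (cong (⟨_,_,_,_,_⟩ false false (+ 0) (+ 0)) (lemma (+ v)))
    where
    lemma : ∀ v → - v - + 1 ≡ - (+ 1 + v)
    lemma = solve-∀

  action-bump : ∀ u s → pow (action bumpʷ) u ⟨ false , false , + 0 , + 0 , s ⟩ ≡ ⟨ false , false , + 0 , + u , s ⟩
  action-bump zero    s = refl
  action-bump (suc u) s =
    trans (cong (action bumpʷ) (action-bump u s)) (cong₂ (⟨_,_,_,_,_⟩ false false (+ 0)) (lemma₁ (+ u)) (lemma₂ s))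
    where
    lemma₁ : ∀ u → u + + 1 + + 0 ≡ + 1 + u
    lemma₁ = solve-∀
    lemma₂ : ∀ s → s + + 1 - + 1 ≡ s
    lemma₂ = solve-∀

  action-reflect : ∀ b u s → action (reflectʷ b) ⟨ false , false , + 0 , u , s ⟩ ≡ ⟨ b , false , + 0 , u , s ⟩
  action-reflect false u s = refl
  action-reflect true  u s = cong (λ u′ → ⟨ true , false , + 0 , u′ , s ⟩) (ℤ.+-identityʳ u)

  action-canonical : ∀ c → action (canonicalʷ c) origin ≡ canonical c
  action-canonical (index b u v k) = cong (pow _·η₁ (toℕ k)) (begin
      action (reflectʷ b) (pow (action bumpʷ) (toℕ u) (pow (_·η₂ ⨾ _·η₂) (toℕ v) origin))
        ≡⟨ cong (action (reflectʷ b) ∘ pow (action bumpʷ) (toℕ u)) (action-η₂η₂ (toℕ v)) ⟩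
      action (reflectʷ b) (pow (action bumpʷ) (toℕ u) ⟨ false , false , + 0 , + 0 , - rep v ⟩)
        ≡⟨ cong (action (reflectʷ b)) (action-bump (toℕ u) (- rep v)) ⟩
      action (reflectʷ b) ⟨ false , false , + 0 , rep u , - rep v ⟩
        ≡⟨ action-reflect b (rep u) (- rep v) ⟩
      ⟨ b , false , + 0 , rep u , - rep v ⟩ ∎)
    where open ≡-Reasoning

  realises-canonical : ∀ c → Realises (perm (canonicalʷ c)) (canonical c)
  realises-canonical c = subst (Realises (perm (canonicalʷ c))) (action-canonical c)
    (realises-word (word (canonicalʷ c)) realises-idf)

  first-pow-·η₁ : ∀ k p i → first (pow _·η₁ k p) i ≡ first p i + + k
  first-pow-·η₁ zero    p i = sym (ℤ.+-identityʳ (first p i))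
  first-pow-·η₁ (suc k) p i = begin
    first (pow _·η₁ k p ·η₁) i    ≡⟨ first-·η₁ (pow _·η₁ k p) i ⟩
    first (pow _·η₁ k p) i + + 1  ≡⟨ cong (_+ + 1) (first-pow-·η₁ k p i) ⟩
    first p i + + k + + 1         ≡⟨ ℤ.+-assoc (first p i) (+ k) (+ 1) ⟩
    first p i + + (k ℕ.+ 1)       ≡⟨ cong (_+_ (first p i) ∘ +_) (ℕ.+-comm k 1) ⟩
    first p i + + suc k           ∎
    where open ≡-Reasoning

  second-pow-·η₁ : ∀ k p i j h → second (pow _·η₁ k p) i j h ≡ pow -_ k (second p i j h)
  second-pow-·η₁ zero    p i j h = refl
  second-pow-·η₁ (suc k) p i j h =
    trans (second-·η₁ (pow _·η₁ k p) i j h) (cong -_ (second-pow-·η₁ k p i j h))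

  first-canonical : ∀ b u v k i → first (canonical (index b u v k)) i ≡ signed b i + rep k
  first-canonical b u v k i = trans (first-pow-·η₁ (toℕ k) ⟨ b , false , + 0 , rep u , - rep v ⟩ i)
                                    (cong (_+ rep k) (ℤ.+-identityʳ (signed b i)))

  second-canonical : ∀ b u v k i j h → second (canonical (index b u v k)) i j h
                                     ≡ pow -_ (toℕ k) (signed b (j + rep u + - rep v * i - + bit b * h))
  second-canonical b u v k i j h = trans (second-pow-·η₁ (toℕ k) ⟨ b , false , + 0 , rep u , - rep v ⟩ i j h)
                                         (cong (pow -_ (toℕ k)) (signed-xor b false _))

  2∣n : 2 ℕ.∣ n
  2∣n = subst (2 ℕ.∣_) (sym n≡2wm) (ℕ.m∣m*n (w ℕ.* m))

  module _ ⦃ _ : NonZero n ⦄ ⦃ _ : NonZero m ⦄ where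

    toCanonical : Params → Index
    toCanonical ⟨ b , f , a , u , v ⟩ = index b (residue m u) (residue m (- v)) (residue n (+ 2 * a + + bit f))

    ≅-canonical : ∀ p → p ≅ canonical (toCanonical p)
    ≅-canonical ⟨ b , f , a , u , v ⟩ = ≅₁ , ≅₂
      where
      u′ v′ : Fin m
      u′ = residue m u
      v′ = residue m (- v)
      k : Fin n
      k = residue n (+ 2 * a + + bit f)
      k-parity : toℕ k % 2 ≡ bit f
      k-parity = parity-mod {a = a} 2∣n (rep-residue n _) (bit<2 f)
      v≡ : v ≡ - rep v′ [mod m ]
      v≡ = subst (_≡ - rep v′ [mod m ]) (ℤ.neg-involutive v) (mod-neg (mod-sym (rep-residue m (- v))))
      ≅₁ : ∀ i → first ⟨ b , f , a , u , v ⟩ i ≡ first (canonical (index b u′ v′ k)) i [mod n ]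
      ≅₁ i = mod-trans (mod-+ˡ (signed b i) (mod-sym (rep-residue n (+ 2 * a + + bit f))))
                       (mod-reflexive (sym (first-canonical b u′ v′ k i)))
      ≅₂ : ∀ i j h → second ⟨ b , f , a , u , v ⟩ i j h ≡ second (canonical (index b u′ v′ k)) i j h [mod m ]
      ≅₂ i j h = begin
        signed (b xor f) (j + u + v * i - + bit b * h)     ≡⟨ signed-xor b f _ ⟩
        signed f (signed b (j + u + v * i - + bit b * h))  ≈⟨ signed-cong f (signed-cong b X≡X′) ⟩
        signed f (signed b X′)                             ≡⟨ signed≡pow-neg f _ ⟩
        pow -_ (bit f) (signed b X′)                       ≡⟨ cong (λ r → pow -_ r (signed b X′)) k-parity ⟨
        pow -_ (toℕ k % 2) (signed b X′)                   ≡⟨ pow-involution ℤ.neg-involutive (toℕ k) _ ⟨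
        pow -_ (toℕ k) (signed b X′)                       ≡⟨ second-canonical b u′ v′ k i j h ⟨
        second (canonical (index b u′ v′ k)) i j h     ∎
        where
        open import Relation.Binary.Reasoning.Setoid (mod-setoid m)
        X′ : ℤ
        X′ = j + rep u′ + - rep v′ * i - + bit b * h
        X≡X′ : j + u + v * i - + bit b * h ≡ X′ [mod m ]
        X≡X′ = mod-+ʳ (- (+ bit b * h)) (mod-+ (mod-+ˡ j (mod-sym (rep-residue m u))) (mod-*ʳ i v≡))


module Counting (n m w : ℕ) (n≡2wm : n ≡ 2 ℕ.* (w ℕ.* m)) (2<n : 2 ℕ.< n) (0<m : 0 ℕ.< m) where

  open Congruence
  open Representatives
  open Iteration
  open Enumeration
  open Realisation n m w n≡2wm
  open import Data.Nat as ℕ using (ℕ; zero; suc; _≤_; _<_; s≤s; z≤n; _/_; _%_; NonZero; >-nonZero)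
  import Data.Nat.Properties as ℕ
  import Data.Nat.Divisibility as ℕ
  open import Data.Bool using (Bool; true; false)
  open import Data.Nat.DivMod using (m<n⇒m/n≡0; m%n<n; m≡m%n+[m/n]*n)
  open import Data.Fin using (Fin; toℕ; fromℕ<)
  open import Data.Fin.Properties as Fin using (*↔×; 2↔Bool)
  open import Data.Integer as ℤ using (+_; -_; _+_; _-_; _*_)
  import Data.Integer.Properties as ℤ
  open import Data.Integer.Tactic.RingSolver using (solve-∀)
  open import Data.Product using (Σ; _×_; _,_; proj₁; proj₂)
  open import Data.Product.Function.NonDependent.Propositional using (_×-↔_)
  open import Data.List.Relation.Unary.Any using (here; there)
  open import Function using (_∘_; _∘′_; _⟨_⟩_; _↔_; Inverse)
  open import Function.Properties.Inverse using (↔-refl; ↔-trans)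
  open import Relation.Binary.PropositionalEquality
  open import Relation.Nullary using (¬_; contradiction)

  1<n : 1 < n
  1<n = ℕ.<-trans (s≤s (s≤s z≤n)) 2<n

  0<n : 0 < n
  0<n = ℕ.<-trans (s≤s z≤n) 1<n

  instance
    n-nonZero : NonZero n
    n-nonZero = >-nonZero 0<n
    m-nonZero : NonZero m
    m-nonZero = >-nonZero 0<m

  0ⁿ 1ⁿ : Fin n
  0ⁿ = fromℕ< 0<n
  1ⁿ = fromℕ< 1<n

  0ᵐ : Fin m
  0ᵐ = fromℕ< 0<m

  rep-1ⁿ : rep 1ⁿ ≡ + 1
  rep-1ⁿ = rep-fromℕ< 1<n

  first-canonical-at : ∀ b u v k {a} (a<n : a < n) →
    first (canonical (index b u v k)) (rep (fromℕ< a<n)) ≡ signed b (+ a) + rep k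
  first-canonical-at b u v k a<n =
    trans (first-canonical b u v k _) (cong (λ x → signed b x + rep k) (rep-fromℕ< a<n))

  second-canonical-at : ∀ b u v k {a} (a<n : a < n) → a < 2 →
    second (canonical (index b u v k)) (rep (fromℕ< a<n)) (rep 0ᵐ) (half (fromℕ< a<n))
      ≡ pow -_ (toℕ k) (signed b (rep u + - rep v * + a))
  second-canonical-at b u v k {a} a<n a<2 =
    trans (second-canonical b u v k (rep (fromℕ< a<n)) (rep 0ᵐ) (half (fromℕ< a<n)))
          (cong (pow -_ (toℕ k) ∘′ signed b) (begin
      rep 0ᵐ + rep u + - rep v * rep (fromℕ< a<n) - + bit b * half (fromℕ< a<n)
        ≡⟨ cong₂ (λ x y → x + rep u + - rep v * rep (fromℕ< a<n) - + bit b * y) (rep-fromℕ< 0<m) half≡0 ⟩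
      + 0 + rep u + - rep v * rep (fromℕ< a<n) - + bit b * + 0
        ≡⟨ cong (λ x → + 0 + rep u + - rep v * x - + bit b * + 0) (rep-fromℕ< a<n) ⟩
      + 0 + rep u + - rep v * + a - + bit b * + 0
        ≡⟨ lemma (rep u) (rep v) (+ a) (+ bit b) ⟩
      rep u + - rep v * + a ∎))
    where
    open ≡-Reasoning
    half≡0 : half (fromℕ< a<n) ≡ + 0
    half≡0 = cong (λ x → + (x / 2)) (Fin.toℕ-fromℕ< a<n) ⟨ trans ⟩ cong +_ (m<n⇒m/n≡0 a<2)
    lemma : ∀ u v a b → + 0 + u + - v * a - b * + 0 ≡ u + - v * a
    lemma = solve-∀

  private variable
    b b′ : Bool
    u u′ v v′ : Fin m
    k k′ : Fin n

  1≢-1 : ¬ (+ 1 ≡ - + 1 [mod n ])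
  1≢-1 p = contradiction (<-mod-injective 2<n 0<n (mod-+ʳ (+ 1) p)) λ ()

  record Agree (c c′ : Index) : Set where
    field
      first-agrees  : ∀ (i : Fin n) → first (canonical c) (rep i) ≡ first (canonical c′) (rep i) [mod n ]
      second-agrees : ∀ (i : Fin n) (j : Fin m) → second (canonical c) (rep i) (rep j) (half i)
                            ≡ second (canonical c′) (rep i) (rep j) (half i) [mod m ]
  open Agree

  signed-0 : ∀ b → signed b (+ 0) ≡ + 0
  signed-0 false = refl
  signed-0 true  = refl

  agree-translation : Agree (index b u v k) (index b′ u′ v′ k′) → k ≡ k′
  agree-translation {b} {u} {v} {k} {b′} {u′} {v′} {k′} agree = rep-injective
    (subst₂ _≡_[mod n ] (at-0 b u v k) (at-0 b′ u′ v′ k′) (first-agrees agree 0ⁿ))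
    where
    at-0 : ∀ b u v k → first (canonical (index b u v k)) (rep 0ⁿ) ≡ rep k
    at-0 b u v k = trans (first-canonical-at b u v k 0<n)
                         (trans (cong (_+ rep k) (signed-0 b)) (ℤ.+-identityˡ (rep k)))

  agree-reflection : Agree (index b u v k) (index b′ u′ v′ k′) → k ≡ k′ → b ≡ b′
  agree-reflection {b} {u} {v} {k} {b′} {u′} {v′} agree refl = signs-at-1 b b′ (mod-+-cancelʳ (rep k)
    (subst₂ _≡_[mod n ] (first-canonical-at b u v k 1<n) (first-canonical-at b′ u′ v′ k 1<n) (first-agrees agree 1ⁿ)))
    where
    signs-at-1 : ∀ b b′ → signed b (+ 1) ≡ signed b′ (+ 1) [mod n ] → b ≡ b′
    signs-at-1 false false _ = refl
    signs-at-1 true  true  _ = refl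
    signs-at-1 false true  p = contradiction p 1≢-1
    signs-at-1 true  false p = contradiction (mod-sym p) 1≢-1

  agree-second-at : Agree (index b u v k) (index b′ u′ v′ k′) → k ≡ k′ → b ≡ b′ →
                    ∀ {a} → a < n → a < 2 → rep u + - rep v * + a ≡ rep u′ + - rep v′ * + a [mod m ]
  agree-second-at {b} {u} {v} {k} {u′ = u′} {v′} agree refl refl a<n a<2 =
    signed-cancel b (pow-neg-cancel (toℕ k)
      (subst₂ _≡_[mod m ] (second-canonical-at b u v k a<n a<2) (second-canonical-at b u′ v′ k a<n a<2)
              (second-agrees agree (fromℕ< a<n) 0ᵐ)))

  agree-offset : Agree (index b u v k) (index b′ u′ v′ k′) → k ≡ k′ → b ≡ b′ → u ≡ u′
  agree-offset {u = u} {v} {u′ = u′} {v′} agree k≡k′ b≡b′ = rep-injective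
    (subst₂ _≡_[mod m ] (lemma (rep u) (rep v)) (lemma (rep u′) (rep v′))
            (agree-second-at agree k≡k′ b≡b′ 0<n (s≤s z≤n)))
    where
    lemma : ∀ u v → u + - v * + 0 ≡ u
    lemma = solve-∀

  agree-slope : Agree (index b u v k) (index b′ u′ v′ k′) → k ≡ k′ → b ≡ b′ → u ≡ u′ → v ≡ v′
  agree-slope {u = u} {v} {v′ = v′} agree k≡k′ b≡b′ refl =
    rep-injective (signed-cancel true (mod-+-cancelʳ (rep u)
      (subst₂ _≡_[mod m ] (lemma (rep u) (rep v)) (lemma (rep u) (rep v′))
              (agree-second-at agree k≡k′ b≡b′ 1<n (s≤s (s≤s z≤n))))))
    where
    lemma : ∀ u v → u + - v * + 1 ≡ - v + u
    lemma = solve-∀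

  agree-injective : ∀ {c c′} → Agree c c′ → c ≡ c′
  agree-injective {index b u v k} {index b′ u′ v′ k′} agree =
    cong₂ _,_ (cong₂ _,_ (cong₂ _,_ b≡b′ u≡u′) (agree-slope agree k≡k′ b≡b′ u≡u′)) k≡k′
    where
    k≡k′ : k ≡ k′
    k≡k′ = agree-translation agree
    b≡b′ : b ≡ b′
    b≡b′ = agree-reflection agree k≡k′
    u≡u′ : u ≡ u′
    u≡u′ = agree-offset agree k≡k′ b≡b′

  canonical-injective : ∀ {g} c c′ → Realises g (canonical c) → Realises g (canonical c′) → c ≡ c′
  canonical-injective c c′ ρ σ = agree-injective {c} {c′} record
    { first-agrees = λ i → proj₁ (realisations-agree ρ σ i 0ᵐ)
    ; second-agrees = λ i j → proj₂ (realisations-agree ρ σ i j) }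

  fixed-by : ∀ {g p} → Realises g p → g ≈ idf → ∀ i j →
             rep i ≡ first p (rep i) [mod n ] × rep j ≡ second p (rep i) (rep j) (half i) [mod m ]
  fixed-by {p = p} ρ g≈idf i j with subst ((i , j) ⟨ p ⟩↦_) (g≈idf (i , j)) (at ρ (i , j))
  ... | maps ρ₁ ρ₂ = ρ₁ , ρ₂

  ≅-origin-idf : ∀ {g p} → Realises g p → p ≅ origin → g ≈ idf
  ≅-origin-idf ρ p≅origin = ≈-from-realisations (realises-≅ ρ p≅origin) realises-idf

  realises-pow : ∀ {w φ} → Word w φ → ∀ k → Realises (pow w k) (pow φ k origin)
  realises-pow W k = realises-word (word-pow W k) realises-idf

  η₁-order : HasOrder (η₁ n m) n
  η₁-order = 0<n , ≅-origin-idf (realises-pow ([] ∷η₁) n) (≅₁ , ≅₂) , non-identity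
    where
    ≅₁ : ∀ i → first (pow _·η₁ n origin) i ≡ first origin i [mod n ]
    ≅₁ i = mod-trans (mod-reflexive (first-pow-·η₁ n origin i)) (mod-+-modulus (first origin i))
    ≅₂ : ∀ i j h → second (pow _·η₁ n origin) i j h ≡ second origin i j h [mod m ]
    ≅₂ i j h = mod-reflexive (begin
      second (pow _·η₁ n origin) i j h       ≡⟨ second-pow-·η₁ n origin i j h ⟩
      pow -_ n (second origin i j h)         ≡⟨ pow-involution ℤ.neg-involutive n _ ⟩
      pow -_ (n % 2) (second origin i j h)   ≡⟨ cong (λ r → pow -_ r (second origin i j h)) (ℕ.n∣m⇒m%n≡0 n 2 2∣n) ⟩
      second origin i j h                    ∎)
      where open ≡-Reasoning
    non-identity : ∀ k → 1 ≤ k → k < n → ¬ (pow (η₁ n m) k ≈ idf)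
    non-identity k 1≤k k<n ηᵏ≈idf = ℕ.<⇒≢ 1≤k (sym (<-mod-injective k<n 0<n (mod-sym (begin
      + 0                              ≡⟨ rep-fromℕ< 0<n ⟨
      rep 0ⁿ                           ≈⟨ proj₁ (fixed-by (realises-pow ([] ∷η₁) k) ηᵏ≈idf 0ⁿ 0ᵐ) ⟩
      first (pow _·η₁ k origin) (rep 0ⁿ) ≡⟨ first-pow-·η₁ k origin (rep 0ⁿ) ⟩
      first origin (rep 0ⁿ) + + k      ≡⟨ cong (λ x → first origin x + + k) (rep-fromℕ< 0<n) ⟩
      + k                              ∎))))
      where open import Relation.Binary.Reasoning.Setoid (mod-setoid n)

  realises-η₂-pow-even : ∀ q → Realises (pow (η₂ n m) (q ℕ.* 2)) ⟨ false , false , + 0 , + 0 , - + q ⟩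
  realises-η₂-pow-even q = realises-resp-≈ (λ x → sym (pow-double (η₂ n m) q x))
    (subst (Realises _) (action-η₂η₂ q) (realises-pow ([] ∷η₂ ∷η₂) q))

  η₂-order : HasOrder (η₂ n m) (2 ℕ.* m)
  η₂-order = ℕ.≤-trans 0<m (ℕ.m≤n*m m 2) , identity , non-identity
    where
    identity : pow (η₂ n m) (2 ℕ.* m) ≈ idf
    identity x = trans (cong (λ k → pow (η₂ n m) k x) (ℕ.*-comm 2 m))
      (≅-origin-idf (realises-η₂-pow-even m) ((λ _ → mod-refl) , λ i j h → ≅₂ i j h) x)
      where
      lemma : ∀ i j h m → j + + 0 + - m * i - + 0 * h ≡ (j + + 0 + + 0 * i - + 0 * h) + (- i) * m
      lemma = solve-∀
      ≅₂ : ∀ i j h → j + + 0 + - + m * i - + 0 * h ≡ j + + 0 + + 0 * i - + 0 * h [mod m ]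
      ≅₂ i j h = subst (_≡ _ [mod m ]) (sym (lemma i j h (+ m))) (mod-multiple _ (- i))
    even : ∀ q → 0 < q → q < m → ¬ (pow (η₂ n m) (q ℕ.* 2) ≈ idf)
    even q 0<q q<m η₂²ᵠ≈idf = ℕ.<⇒≢ 0<q (<-mod-injective 0<m q<m
      (subst (λ x → + 0 ≡ x [mod m ]) (ℤ.neg-involutive (+ q)) (mod-neg {x = + 0} (mod-+-cancelʳ (rep 0ᵐ) 0≡-q))))
      where
      lemma : ∀ z q h → z + + 0 + - q * + 1 - + 0 * h ≡ - q + z
      lemma = solve-∀
      0≡-q : + 0 + rep 0ᵐ ≡ - + q + rep 0ᵐ [mod m ]
      0≡-q = begin
        + 0 + rep 0ᵐ                                 ≡⟨ ℤ.+-identityˡ (rep 0ᵐ) ⟩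
        rep 0ᵐ                                       ≈⟨ proj₂ (fixed-by (realises-η₂-pow-even q) η₂²ᵠ≈idf 1ⁿ 0ᵐ) ⟩
        rep 0ᵐ + + 0 + - + q * rep 1ⁿ - + 0 * half 1ⁿ ≡⟨ cong (λ x → rep 0ᵐ + + 0 + - + q * x - + 0 * half 1ⁿ) rep-1ⁿ ⟩
        rep 0ᵐ + + 0 + - + q * + 1 - + 0 * half 1ⁿ    ≡⟨ lemma (rep 0ᵐ) (+ q) (half 1ⁿ) ⟩
        - + q + rep 0ᵐ                               ∎
        where open import Relation.Binary.Reasoning.Setoid (mod-setoid m)
    odd : ∀ q → ¬ (pow (η₂ n m) (suc (q ℕ.* 2)) ≈ idf)
    odd q η₂²ᵠ⁺¹≈idf = 1≢-1 (begin
      + 1                ≡⟨ rep-1ⁿ ⟨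
      rep 1ⁿ             ≈⟨ proj₁ (fixed-by (realises-word ([] ∷η₂) (realises-η₂-pow-even q)) η₂²ᵠ⁺¹≈idf 1ⁿ 0ᵐ) ⟩
      - rep 1ⁿ + + 0     ≡⟨ cong (λ x → - x + + 0) rep-1ⁿ ⟩
      - + 1 + + 0        ≡⟨ ℤ.+-identityʳ (- + 1) ⟩
      - + 1              ∎)
      where open import Relation.Binary.Reasoning.Setoid (mod-setoid n)
    non-identity : ∀ k → 1 ≤ k → k < 2 ℕ.* m → ¬ (pow (η₂ n m) k ≈ idf)
    non-identity k 1≤k k<2m ηᵏ≈idf with k % 2 | k / 2 | m%n<n k 2 | m≡m%n+[m/n]*n k 2
    ... | 0 | zero  | _ | refl = contradiction 1≤k λ ()
    ... | 0 | suc q | _ | refl =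
      even (suc q) (s≤s z≤n) (ℕ.*-cancelʳ-< 2 (suc q) m (subst (suc q ℕ.* 2 <_) (ℕ.*-comm 2 m) k<2m)) ηᵏ≈idf
    ... | 1 | q     | _ | refl = odd q ηᵏ≈idf
    ... | suc (suc _) | _ | s≤s (s≤s ()) | _

  η₁η₂-order : HasOrder (η₁ n m ⨾ η₂ n m) 2
  η₁η₂-order = s≤s z≤n , ≈-from-realisations (realises-pow ([] ∷η₁ ∷η₂) 2) realises-idf , non-identity
    where
    non-identity : ∀ k → 1 ≤ k → k < 2 → ¬ (pow (η₁ n m ⨾ η₂ n m) k ≈ idf)
    non-identity (suc (suc _)) _ (s≤s (s≤s ()))
    non-identity 1 _ _ η₁η₂≈idf = contradiction (<-mod-injective 1<n 0<n (begin
      + 1                          ≡⟨ ℤ.neg-involutive (+ 1) ⟨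
      - (- + 1)                    ≈⟨ mod-neg (mod-sym (begin
        rep 0ⁿ                     ≈⟨ proj₁ (fixed-by (realises-pow ([] ∷η₁ ∷η₂) 1) η₁η₂≈idf 0ⁿ 0ᵐ) ⟩
        - rep 0ⁿ + - + 1           ≡⟨ cong (λ x → - x + - + 1) (rep-fromℕ< 0<n) ⟩
        - + 1                      ∎)) ⟩
      - rep 0ⁿ                     ≡⟨ cong -_ (rep-fromℕ< 0<n) ⟩
      + 0                          ∎)) λ ()
      where open import Relation.Binary.Reasoning.Setoid (mod-setoid n)

  η₁-cancel : pow (η₁ n m) (suc (ℕ.pred n)) ≈ idf
  η₁-cancel = subst (λ k → pow (η₁ n m) k ≈ idf) (sym (ℕ.suc-pred n)) (proj₁ (proj₂ η₁-order))

  η₂-cancel : pow (η₂ n m) (suc (ℕ.pred (2 ℕ.* m))) ≈ idf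
  η₂-cancel = subst (λ k → pow (η₂ n m) k ≈ idf) (sym (ℕ.suc-pred (2 ℕ.* m) ⦃ ℕ.m*n≢0 2 m ⦄))
                    (proj₁ (proj₂ η₂-order))

  ≈-canonical : ∀ {g p} → Realises g p → g ≈ perm (canonicalʷ (toCanonical p))
  ≈-canonical {p = p} ρ =
    ≈-from-realisations (realises-≅ ρ (≅-canonical p)) (realises-canonical (toCanonical p))

  realises-⨾ : ∀ {g h p q} → Realises g p → Realises h q →
               Realises (g ⨾ h) (action (canonicalʷ (toCanonical q)) p)
  realises-⨾ {g} {q = q} ρ σ =
    realises-resp-≈ (λ x → sym (≈-canonical σ (g x))) (realises-word (word (canonicalʷ (toCanonical q))) ρ)

  realises-inverse : ∀ {g h q} → Realises g q → (∀ x → h (g x) ≡ x) → Σ Params (Realises h)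
  realises-inverse {g} {h} {q} σ h∘g≡id =
    action W′ origin , realises-resp-≈ W′≈h (realises-word (word W′) realises-idf)
    where
    inverse : Σ PositiveWord λ W′ → ∀ x → perm (canonicalʷ (toCanonical q)) (perm W′ x) ≡ x
    inverse = rightInverse (ℕ.pred n) (ℕ.pred (2 ℕ.* m)) η₁-cancel η₂-cancel (word (canonicalʷ (toCanonical q)))
    W′ : PositiveWord
    W′ = proj₁ inverse
    W′≈h : perm W′ ≈ h
    W′≈h y = begin
      perm W′ y                                         ≡⟨ h∘g≡id (perm W′ y) ⟨
      h (g (perm W′ y))                                 ≡⟨ cong h (≈-canonical σ (perm W′ y)) ⟩
      h (perm (canonicalʷ (toCanonical q)) (perm W′ y)) ≡⟨ cong h (proj₂ inverse y) ⟩
      h y                                               ∎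
      where open ≡-Reasoning

  gen-realised : ∀ {g} → Gen generators g → Σ Params (Realises g)
  gen-realised one                       = origin , realises-idf
  gen-realised (gen (here refl))         = _ , realises-word ([] ∷η₁) realises-idf
  gen-realised (gen (there (here refl))) = _ , realises-word ([] ∷η₂) realises-idf
  gen-realised (mul G H)                 = _ , realises-⨾ (proj₂ (gen-realised G)) (proj₂ (gen-realised H))
  gen-realised (inv G h∘g≡id)            = realises-inverse (proj₂ (gen-realised G)) h∘g≡id

  index↔ : Fin (2 ℕ.* m ℕ.* m ℕ.* n) ↔ Index
  index↔ = ↔-trans *↔× ((↔-trans *↔× ((↔-trans *↔× (2↔Bool ×-↔ ↔-refl)) ×-↔ ↔-refl)) ×-↔ ↔-refl)

  H-card : HasCard (Gen generators) (2 ℕ.* m ℕ.* m ℕ.* n)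
  H-card = hasCard-enumeration (perm ∘ canonicalʷ ∘ to) (word-∈ ∘ word ∘ canonicalʷ ∘ to) injective complete
    where
    open Inverse index↔
    injective : ∀ x y → perm (canonicalʷ (to x)) ≈ perm (canonicalʷ (to y)) → x ≡ y
    injective x y e = begin
      x            ≡⟨ strictlyInverseʳ x ⟨
      from (to x)  ≡⟨ cong from (canonical-injective (to x) (to y) (realises-canonical (to x))
                                   (realises-resp-≈ (sym ∘ e) (realises-canonical (to y)))) ⟩
      from (to y)  ≡⟨ strictlyInverseʳ y ⟩
      y            ∎
      where open ≡-Reasoning
    complete : ∀ g → Gen generators g → Σ (Fin (2 ℕ.* m ℕ.* m ℕ.* n)) λ x → g ≈ perm (canonicalʷ (to x))
    complete g G with gen-realised G
    ... | p , ρ = from (toCanonical p) , λ y →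
      trans (≈-canonical ρ y) (cong (λ c → perm (canonicalʷ c) y) (sym (strictlyInverseˡ (toCanonical p))))


open import Data.Nat using (ℕ; _*_; _≤_; _<_; s≤s; z≤n; >-nonZero)
import Data.Nat.Properties as ℕ
open import Data.Nat.Divisibility using (_∣_; divides)
open import Data.List using (_∷_; [])
open import Data.Product using (_×_; _,_)
open import Relation.Binary.PropositionalEquality using (trans; cong)
open import Relation.Nullary using (¬_)

lemma5p6 : (m s : ℕ) → 3 ≤ m → ¬ (2 ∣ m) → 0 < s → 2 ∣ s → ¬ (4 ∣ s) →
    HasOrder (η₁ (s * m) m) (s * m)
    × HasOrder (η₂ (s * m) m) (2 * m)
    × HasOrder (η₁ (s * m) m ⨾ η₂ (s * m) m) 2
    × HasCard (Gen (η₁ (s * m) m ∷ η₂ (s * m) m ∷ [])) (2 * m * m * (s * m))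
lemma5p6 m s 3≤m _ 0<s (divides w s≡w*2) _ = η₁-order , η₂-order , η₁η₂-order , H-card
  where
  sm≡2wm : s * m ≡ 2 * (w * m)
  sm≡2wm = trans (cong (_* m) (trans s≡w*2 (ℕ.*-comm w 2))) (ℕ.*-assoc 2 w m)
  open Counting (s * m) m w sm≡2wm (ℕ.<-≤-trans 3≤m (ℕ.m≤n*m m s ⦃ >-nonZero 0<s ⦄)) (ℕ.≤-trans (s≤s z≤n) 3≤m)
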